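{- If $G$ is a full DAG with an ample framing $F$, then every edge of $G$ lies on a unique exceptional route.
   Context: A DAG is a finite directed acyclic graph, possibly with multiple edges; sources have no incoming edges, sinks no outgoing edges, other vertices are inner; $\mathrm{in}(v),\mathrm{out}(v)$ are incoming/outgoing edges. $G$ is full if every inner vertex $v$ has $|\mathrm{in}(v)|=|\mathrm{out}(v)|=2$. A route is a maximal directed path (source to sink). A framing assigns to each inner vertex $v$ linear orders $\prec$ on $\mathrm{in}(v)$ and $\mathrm{out}(v)$. For inner $v$, paths in $\mathrm{Out}(v)$ (from $v$ to a sink) are compared by $P\prec Q$ iff at the last vertex $w$ of their common initial segment the edge of $P$ leaving $w$ precedes that of $Q$ in $\mathrm{out}(w)$; analogously for $\mathrm{In}(v)$ (paths from a source to $v$) at the first vertex of their common final segment using $\mathrm{in}(w)$. For a route $R$ through $v$, $Rv$, $vR$ are its parts before/after $v$. Routes $P,Q$ through a common inner vertex $v$ conflict at $v$ if, after possibly swapping them, $Pv\prec Qv$ and $vQ\prec vP$; coherent if no conflict at any common inner vertex. A route is exceptional if coherent with all routes. With $\mathcal{F}_+(G)\subset\mathbb{R}^{E(G)}$ the cone of nonnegative flows (conservation at inner vertices) and $v_R$ the indicator vector of $R$, a framing is ample if $\{v_R:R\text{ exceptional}\}$ lies in no facet of $\mathcal{F}_+(G)$ (equivalently, every non-idle edge lies on an exceptional route; an edge is idle if it is the only incoming or only outgoing edge of an inner vertex). -}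

module Defs where

open import Data.Nat using (ℕ)
open import Data.Fin using (Fin; _≟_)
open import Data.List using (List; []; _∷_; _++_; reverse; filter; length)
open import Data.List.Membership.Propositional using (_∈_)
open import Data.Product using (Σ; ∃; _×_; _,_)
open import Data.Sum using (_⊎_)
open import Data.Empty using (⊥)
open import Relation.Nullary using (¬_)
open import Relation.Binary.PropositionalEquality using (_≡_; _≢_)
open import Data.List.Base using (allFin)

record Graph : Set where
  field
    n   : ℕ
    m   : ℕ
    src : Fin m → Fin n
    tgt : Fin m → Fin n

module _ (G : Graph) where
  open Graph G

  V : Set
  V = Fin n

  E : Set
  E = Fin m

  data PathFrom : V → List E → V → Set where
    nil  : ∀ {v} → PathFrom v [] v
    cons : ∀ {u w e P} → src e ≡ u → PathFrom (tgt e) P w → PathFrom u (e ∷ P) w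

  Acyclic : Set
  Acyclic = ∀ v e P → ¬ PathFrom v (e ∷ P) v

  IsSource : V → Set
  IsSource v = ∀ e → tgt e ≢ v

  IsSink : V → Set
  IsSink v = ∀ e → src e ≢ v

  IsInner : V → Set
  IsInner v = ¬ IsSource v × ¬ IsSink v

  inDeg : V → ℕ
  inDeg v = length (filter (λ e → tgt e ≟ v) (allFin m))

  outDeg : V → ℕ
  outDeg v = length (filter (λ e → src e ≟ v) (allFin m))

  Full : Set
  Full = ∀ v → IsInner v → inDeg v ≡ 2 × outDeg v ≡ 2

  -- route: maximal directed path, i.e. a (nonempty) path from a source to a sink
  IsRoute : List E → Set
  IsRoute R = (R ≢ []) × Σ V λ u → Σ V λ w → PathFrom u R w × IsSource u × IsSink w

  Idle : E → Set
  Idle e = Σ V λ v → IsInner v ×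
             ((tgt e ≡ v × ∀ f → tgt f ≡ v → f ≡ e)
             ⊎ (src e ≡ v × ∀ f → src f ≡ v → f ≡ e))

record DAG : Set₁ where
  field
    graph   : Graph
    acyclic : Acyclic graph
  open Graph graph public

record LinearOrderOn {A : Set} (S : A → Set) (lt : A → A → Set) : Set where
  field
    support : ∀ {e f} → lt e f → S e × S f
    irrefl  : ∀ {e} → ¬ lt e e
    trans   : ∀ {e f g} → lt e f → lt f g → lt e g
    total   : ∀ {e f} → S e → S f → e ≢ f → lt e f ⊎ lt f e

module _ (G : DAG) where
  open DAG G

  record Framing : Set₁ where
    field
      inLt  : V graph → E graph → E graph → Set
      outLt : V graph → E graph → E graph → Set
      inOrd  : ∀ v → IsInner graph v → LinearOrderOn (λ e → tgt e ≡ v) (inLt v)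
      outOrd : ∀ v → IsInner graph v → LinearOrderOn (λ e → src e ≡ v) (outLt v)

  module _ (F : Framing) where
    open Framing F

    -- comparison of paths in Out(v): at the last vertex of the common
    -- initial segment, compare the outgoing edges
    OutPrec : List (E graph) → List (E graph) → Set
    OutPrec [] _ = ⊥
    OutPrec (_ ∷ _) [] = ⊥
    OutPrec (e ∷ P) (f ∷ Q) = (e ≡ f × OutPrec P Q) ⊎ (e ≢ f × outLt (src e) e f)

    InPrecRev : List (E graph) → List (E graph) → Set
    InPrecRev [] _ = ⊥
    InPrecRev (_ ∷ _) [] = ⊥
    InPrecRev (e ∷ P) (f ∷ Q) = (e ≡ f × InPrecRev P Q) ⊎ (e ≢ f × inLt (tgt e) e f)

    -- comparison of paths in In(v): at the first vertex of the common
    -- final segment, compare the incoming edges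
    InPrec : List (E graph) → List (E graph) → Set
    InPrec P Q = InPrecRev (reverse P) (reverse Q)

    Conflict : V graph → List (E graph) → List (E graph) → Set
    Conflict v P Q =
      Σ (List (E graph)) λ Pv → Σ (List (E graph)) λ vP →
      Σ (List (E graph)) λ Qv → Σ (List (E graph)) λ vQ →
        P ≡ Pv ++ vP × Q ≡ Qv ++ vQ ×
        (Σ (V graph) λ s → PathFrom graph s Pv v) ×
        (Σ (V graph) λ s → PathFrom graph s Qv v) ×
        ((InPrec Pv Qv × OutPrec vQ vP) ⊎ (InPrec Qv Pv × OutPrec vP vQ))

    Coherent : List (E graph) → List (E graph) → Set
    Coherent P Q = ∀ v → IsInner graph v → ¬ Conflict v P Q

    Exceptional : List (E graph) → Set
    Exceptional R = IsRoute graph R × (∀ Q → IsRoute graph Q → Coherent R Q)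

    -- ample framing (edge characterization): every non-idle edge lies on an
    -- exceptional route
    Ample : Set
    Ample = ∀ e → ¬ Idle graph e → Σ (List (E graph)) λ R → Exceptional R × e ∈ R

{-# OPTIONS --safe #-}

-- Fullness rules out idle edges, so ampleness already gives an exceptional route through
-- every edge; the content is uniqueness. Suppose exceptional routes R, R′ enter an inner
-- vertex v through the same edge c but leave it through a ≠ a′. Let d be the other edge
-- into v and T an exceptional route through d; splicing T up to d with the continuation
-- of R′, resp. R, gives routes Q, Q′. Whatever the orders of {c, d} and {a, a′} at v, either
-- R conflicts with Q or R′ with Q′ at v. So exceptional routes sharing an edge share the
-- next one and, dually, the previous one; walking from a common edge in both directions,
-- they coincide.
module Submission where

open import Defs
open import Data.List using (List)
open import Data.List.Membership.Propositional using (_∈_)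
open import Data.Product using (Σ; _×_)
open import Relation.Binary.PropositionalEquality using (_≡_)

open import Data.Empty using (⊥-elim)
open import Data.Fin using (Fin; _≟_)
open import Data.List using ([]; _∷_; _++_; _∷ʳ_; [_]; filter; length; allFin)
open import Data.List.Properties using (++-conicalʳ; ∷ʳ-++; reverse-++)
open import Data.List.Membership.Propositional.Properties using (∈-∃++; ∈-filter⁻)
open import Data.List.Relation.Unary.All using (_∷_)
open import Data.List.Relation.Unary.AllPairs using (_∷_)
open import Data.List.Relation.Unary.Any using (here; there)
open import Data.List.Relation.Unary.Unique.Propositional using (Unique)
open import Data.List.Relation.Unary.Unique.Propositional.Properties using (allFin⁺; filter⁺)
open import Data.List.Reverse using (Reverse; []; _∶_∶ʳ_; reverseView)
open import Data.Nat using (_≤_; s≤s)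
open import Data.Nat.Properties using (≤-reflexive)
open import Data.Product using (_,_; proj₁; proj₂; ∃; ∃₂)
open import Data.Sum using (_⊎_; inj₁; inj₂; [_,_]′)
open import Relation.Binary.Definitions using (DecidableEquality)
open import Relation.Binary.PropositionalEquality using (_≢_; refl; sym; trans; cong; cong₂; subst)
open import Relation.Nullary using (¬_; yes; no)

module _ {A B : Set} (_<₁_ : A → A → Set) (_<₂_ : B → B → Set) where

  Crossing : A × B → A × B → Set
  Crossing (x , p) (y , q) = (x <₁ y × q <₂ p) ⊎ (y <₁ x × p <₂ q)

  Crossing-sym : ∀ {s t} → Crossing s t → Crossing t s
  Crossing-sym (inj₁ x<y) = inj₂ x<y
  Crossing-sym (inj₂ y<x) = inj₁ y<x

  crossing-⊎-crossing : ∀ {x y p q} → x <₁ y ⊎ y <₁ x → p <₂ q ⊎ q <₂ p →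
                        Crossing (x , p) (y , q) ⊎ Crossing (x , q) (y , p)
  crossing-⊎-crossing (inj₁ x<y) (inj₁ p<q) = inj₂ (inj₁ (x<y , p<q))
  crossing-⊎-crossing (inj₁ x<y) (inj₂ q<p) = inj₁ (inj₁ (x<y , q<p))
  crossing-⊎-crossing (inj₂ y<x) (inj₁ p<q) = inj₁ (inj₂ (y<x , p<q))
  crossing-⊎-crossing (inj₂ y<x) (inj₂ q<p) = inj₂ (inj₂ (y<x , q<p))

∃-other-member : ∀ {A : Set} → DecidableEquality A → ∀ {xs : List A} →
                 Unique xs → 2 ≤ length xs → ∀ c → ∃ λ d → d ∈ xs × d ≢ c
∃-other-member _ {[]}         _ () _
∃-other-member _ {_ ∷ []}     _ (s≤s ()) _
∃-other-member _≟ᴬ_ {x ∷ y ∷ _} ((x≢y ∷ _) ∷ _) _ c with x ≟ᴬ c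
... | yes refl = y , there (here refl) , λ y≡x → x≢y (sym y≡x)
... | no x≢c   = x , here refl , x≢c

∃-other-preimage : ∀ {m n} (f : Fin m → Fin n) v →
                   2 ≤ length (filter (λ e → f e ≟ v) (allFin m)) →
                   ∀ c → ∃ λ d → f d ≡ v × d ≢ c
∃-other-preimage {m} f v two c
  with d , d∈ , d≢c ← ∃-other-member _≟_ (filter⁺ (λ e → f e ≟ v) {allFin m} (allFin⁺ m)) two c
  = d , proj₂ (∈-filter⁻ (λ e → f e ≟ v) {xs = allFin m} d∈) , d≢c

module Routes (g : Graph) where
  open Graph g

  Initial : List (E g) → V g → Set
  Initial P v = ∃ λ u → PathFrom g u P v × IsSource g u

  Final : V g → List (E g) → Set
  Final v P = ∃ λ w → PathFrom g v P w × IsSink g w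

  PathFrom-++ : ∀ {u v w P Q} → PathFrom g u P v → PathFrom g v Q w → PathFrom g u (P ++ Q) w
  PathFrom-++ nil         q = q
  PathFrom-++ (cons s≡u p) q = cons s≡u (PathFrom-++ p q)

  PathFrom-split : ∀ {u w} P {Q} → PathFrom g u (P ++ Q) w →
                   ∃ λ v → PathFrom g u P v × PathFrom g v Q w
  PathFrom-split []      pq = _ , nil , pq
  PathFrom-split (_ ∷ P) (cons s≡u pq) with v , p , q ← PathFrom-split P pq = v , cons s≡u p , q

  route-split : ∀ X e Y → IsRoute g (X ++ e ∷ Y) → Initial (X ∷ʳ e) (tgt e) × Final (tgt e) Y
  route-split X e Y (_ , u , w , path , source , sink)
    with _ , p , cons s≡v q ← PathFrom-split X path
    = (u , PathFrom-++ p (cons s≡v nil) , source) , (w , q , sink)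

  route-join : ∀ X e Y {v} → Initial (X ∷ʳ e) v → Final v Y → IsRoute g (X ++ e ∷ Y)
  route-join X e Y (u , p , source) (w , q , sink) =
      (λ eq → nonempty (++-conicalʳ X (e ∷ Y) eq))
    , u , w , subst (λ R → PathFrom g u R w) (∷ʳ-++ X e Y) (PathFrom-++ p q) , source , sink
    where
    nonempty : e ∷ Y ≢ []
    nonempty ()

  Final-∷ : ∀ {v b B} → src b ≡ v → Final (tgt b) B → Final v (b ∷ B)
  Final-∷ b↤v (w , path , sink) = w , cons b↤v path , sink

  route-consecutive : ∀ X c a Y → IsRoute g (X ++ c ∷ a ∷ Y) → src a ≡ tgt c
  route-consecutive X c a Y route with _ , (_ , cons s≡v _ , _) ← route-split X c (a ∷ Y) route = s≡v

  route-ends-at-sink : ∀ X e → IsRoute g (X ++ e ∷ []) → IsSink g (tgt e)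
  route-ends-at-sink X e route with _ , (_ , nil , sink) ← route-split X e [] route = sink

  route-starts-at-source : ∀ e Y → IsRoute g (e ∷ Y) → IsSource g (src e)
  route-starts-at-source e Y route with (_ , cons refl nil , source) , _ ← route-split [] e Y route = source

  route-inner : ∀ X c a Y → IsRoute g (X ++ c ∷ a ∷ Y) → IsInner g (tgt c)
  route-inner X c a Y route = (λ source → source c refl)
                            , (λ sink → sink a (route-consecutive X c a Y route))

  other-in-edge : Full g → ∀ {v} → IsInner g v → ∀ c → ∃ λ d → tgt d ≡ v × d ≢ c
  other-in-edge full {v} inner = ∃-other-preimage tgt v (≤-reflexive (sym (proj₁ (full v inner))))

  other-out-edge : Full g → ∀ {v} → IsInner g v → ∀ a → ∃ λ b → src b ≡ v × b ≢ a
  other-out-edge full {v} inner = ∃-other-preimage src v (≤-reflexive (sym (proj₂ (full v inner))))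

  full⇒¬Idle : Full g → ∀ e → ¬ Idle g e
  full⇒¬Idle full e (v , inner , inj₁ (_ , only-in)) with f , f↦v , f≢e ← other-in-edge full inner e
    = f≢e (only-in f f↦v)
  full⇒¬Idle full e (v , inner , inj₂ (_ , only-out)) with f , f↤v , f≢e ← other-out-edge full inner e
    = f≢e (only-out f f↤v)

module Coherence (G : DAG) (F : Framing G) where
  open DAG G
  open Framing F
  open Routes graph

  InPrec-∷ʳ : ∀ {v} → IsInner graph v → ∀ X A {c d} → tgt c ≡ v → inLt v c d →
              InPrec G F (X ∷ʳ c) (A ∷ʳ d)
  InPrec-∷ʳ inner X A {c} {d} refl c<d rewrite reverse-++ X [ c ] | reverse-++ A [ d ] =
    inj₂ ((λ { refl → irrefl c<d }) , c<d)
    where open LinearOrderOn (inOrd _ inner)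

  OutPrec-∷ : ∀ {v} → IsInner graph v → ∀ {a b} P Q → src a ≡ v → outLt v a b →
              OutPrec G F (a ∷ P) (b ∷ Q)
  OutPrec-∷ inner _ _ refl a<b = inj₂ ((λ { refl → irrefl a<b }) , a<b)
    where open LinearOrderOn (outOrd _ inner)

  exceptional-noncrossing : ∀ {X c a Y A d b B v} → Exceptional G F (X ++ c ∷ a ∷ Y) →
                            IsRoute graph (A ++ d ∷ b ∷ B) → tgt c ≡ v → tgt d ≡ v →
                            ¬ Crossing (inLt v) (outLt v) (c , a) (d , b)
  exceptional-noncrossing {X} {c} {a} {Y} {A} {d} {b} {B} (routeP , coherent) routeQ refl d↦v crossing =
    coherent (A ++ d ∷ b ∷ B) routeQ (tgt c) inner
      ( X ∷ʳ c , a ∷ Y , A ∷ʳ d , b ∷ B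
      , sym (∷ʳ-++ X c (a ∷ Y)) , sym (∷ʳ-++ A d (b ∷ B))
      , path-to (proj₁ (route-split X c (a ∷ Y) routeP))
      , path-to (subst (Initial (A ∷ʳ d)) d↦v (proj₁ (route-split A d (b ∷ B) routeQ)))
      , ordered crossing )
    where
    inner = route-inner X c a Y routeP
    a↤v = route-consecutive X c a Y routeP
    b↤v = trans (route-consecutive A d b B routeQ) d↦v

    path-to : ∀ {P v} → Initial P v → ∃ λ u → PathFrom graph u P v
    path-to (u , p , _) = u , p

    ordered : Crossing (inLt (tgt c)) (outLt (tgt c)) (c , a) (d , b) →
              (InPrec G F (X ∷ʳ c) (A ∷ʳ d) × OutPrec G F (b ∷ B) (a ∷ Y))
              ⊎ (InPrec G F (A ∷ʳ d) (X ∷ʳ c) × OutPrec G F (a ∷ Y) (b ∷ B))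
    ordered (inj₁ (c<d , b<a)) = inj₁ (InPrec-∷ʳ inner X A refl c<d , OutPrec-∷ inner B Y b↤v b<a)
    ordered (inj₂ (d<c , a<b)) = inj₂ (InPrec-∷ʳ inner A X d↦v d<c , OutPrec-∷ inner Y B a↤v a<b)

module Uniqueness (G : DAG) (F : Framing G) (full : Full (DAG.graph G)) (ample : Ample G F) where
  open DAG G
  open Framing F
  open Routes graph
  open Coherence G F

  snoc : ∀ Z x {W} → Exceptional G F (Z ++ x ∷ W) → Exceptional G F ((Z ∷ʳ x) ++ W)
  snoc Z x {W} = subst (Exceptional G F) (sym (∷ʳ-++ Z x W))

  unsnoc : ∀ Z x {W} → Exceptional G F ((Z ∷ʳ x) ++ W) → Exceptional G F (Z ++ x ∷ W)
  unsnoc Z x {W} = subst (Exceptional G F) (∷ʳ-++ Z x W)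

  exceptional-split : ∀ e → ∃₂ λ A B → Exceptional G F (A ++ e ∷ B)
  exceptional-split e with _ , exc , e∈R ← ample e (full⇒¬Idle full e)
                      with A , B , refl ← ∈-∃++ e∈R
    = A , B , exc

  next-edge-unique : ∀ {X c a Y X′ a′ Y′} → Exceptional G F (X ++ c ∷ a ∷ Y) →
                     Exceptional G F (X′ ++ c ∷ a′ ∷ Y′) → a ≡ a′
  next-edge-unique {X} {c} {a} {Y} {X′} {a′} {Y′} exc exc′
    with a ≟ a′ | other-in-edge full (route-inner X c a Y (proj₁ exc)) c
  ... | yes a≡a′ | _ = a≡a′
  ... | no a≢a′ | d , d↦v , d≢c with A , B , excT ← exceptional-split d
    = ⊥-elim ([ exceptional-noncrossing exc  (splice a′ Y′ exc′) refl d↦v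
              , exceptional-noncrossing exc′ (splice a  Y  exc)  refl d↦v
              ]′ (crossing-⊎-crossing (inLt (tgt c)) (outLt (tgt c)) in-order out-order))
    where
    inner = route-inner X c a Y (proj₁ exc)
    in-order = LinearOrderOn.total (inOrd _ inner) refl d↦v (λ c≡d → d≢c (sym c≡d))
    out-order = LinearOrderOn.total (outOrd _ inner) (route-consecutive X c a Y (proj₁ exc))
                                    (route-consecutive X′ c a′ Y′ (proj₁ exc′)) a≢a′

    splice : ∀ {Z} a″ Y″ → Exceptional G F (Z ++ c ∷ a″ ∷ Y″) → IsRoute graph (A ++ d ∷ a″ ∷ Y″)
    splice {Z} a″ Y″ excR = route-join A d (a″ ∷ Y″)
      (subst (Initial (A ∷ʳ d)) d↦v (proj₁ (route-split A d B (proj₁ excT))))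
      (proj₂ (route-split Z c (a″ ∷ Y″) (proj₁ excR)))

  previous-edge-unique : ∀ {X c a Y X′ c′ Y′} → Exceptional G F (X ++ c ∷ a ∷ Y) →
                         Exceptional G F (X′ ++ c′ ∷ a ∷ Y′) → c ≡ c′
  previous-edge-unique {X} {c} {a} {Y} {X′} {c′} {Y′} exc exc′
    with c ≟ c′ | other-out-edge full (route-inner X c a Y (proj₁ exc)) a
  ... | yes c≡c′ | _ = c≡c′
  ... | no c≢c′ | b , b↤v , b≢a with A , B , excT ← exceptional-split b
    = ⊥-elim ([ exceptional-noncrossing exc (splice X′ c′ exc′) refl c′↦v
              , (λ crossing → exceptional-noncrossing exc′ (splice X c exc) c′↦v refl
                                (Crossing-sym (inLt (tgt c)) (outLt (tgt c)) crossing))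
              ]′ (crossing-⊎-crossing (inLt (tgt c)) (outLt (tgt c)) in-order out-order))
    where
    inner = route-inner X c a Y (proj₁ exc)
    a↤v = route-consecutive X c a Y (proj₁ exc)
    c′↦v = trans (sym (route-consecutive X′ c′ a Y′ (proj₁ exc′))) a↤v
    in-order = LinearOrderOn.total (inOrd _ inner) refl c′↦v c≢c′
    out-order = LinearOrderOn.total (outOrd _ inner) a↤v b↤v (λ a≡b → b≢a (sym a≡b))

    splice : ∀ Z c″ {Y″} → Exceptional G F (Z ++ c″ ∷ a ∷ Y″) → IsRoute graph (Z ++ c″ ∷ b ∷ B)
    splice Z c″ {Y″} excR = route-join Z c″ (b ∷ B)
      (subst (Initial (Z ∷ʳ c″)) (trans (sym (route-consecutive Z c″ a Y″ (proj₁ excR))) a↤v)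
             (proj₁ (route-split Z c″ (a ∷ Y″) (proj₁ excR))))
      (Final-∷ b↤v (proj₂ (route-split A b B (proj₁ excT))))

  suffix-unique : ∀ {e} X X′ Y Y′ →
                  Exceptional G F (X ++ e ∷ Y) → Exceptional G F (X′ ++ e ∷ Y′) → Y ≡ Y′
  suffix-unique X X′ [] [] _ _ = refl
  suffix-unique {e} X X′ [] (a′ ∷ Y′) exc exc′ =
    ⊥-elim (route-ends-at-sink X e (proj₁ exc) a′ (route-consecutive X′ e a′ Y′ (proj₁ exc′)))
  suffix-unique {e} X X′ (a ∷ Y) [] exc exc′ =
    ⊥-elim (route-ends-at-sink X′ e (proj₁ exc′) a (route-consecutive X e a Y (proj₁ exc)))
  suffix-unique {e} X X′ (a ∷ Y) (a′ ∷ Y′) exc exc′ with refl ← next-edge-unique exc exc′ =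
    cong (a ∷_) (suffix-unique (X ∷ʳ e) (X′ ∷ʳ e) Y Y′ (snoc X e exc) (snoc X′ e exc′))

  prefix-unique : ∀ {e X X′} → Reverse X → Reverse X′ → ∀ Y Y′ →
                  Exceptional G F (X ++ e ∷ Y) → Exceptional G F (X′ ++ e ∷ Y′) → X ≡ X′
  prefix-unique [] [] _ _ _ _ = refl
  prefix-unique {e} [] (X′ ∶ _ ∶ʳ x′) Y Y′ exc exc′ =
    ⊥-elim (route-starts-at-source e Y (proj₁ exc) x′
              (sym (route-consecutive X′ x′ e Y′ (proj₁ (unsnoc X′ x′ exc′)))))
  prefix-unique {e} (X ∶ _ ∶ʳ x) [] Y Y′ exc exc′ =
    ⊥-elim (route-starts-at-source e Y′ (proj₁ exc′) x
              (sym (route-consecutive X x e Y (proj₁ (unsnoc X x exc)))))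
  prefix-unique {e} (X ∶ rX ∶ʳ x) (X′ ∶ rX′ ∶ʳ x′) Y Y′ exc exc′
    with refl ← previous-edge-unique (unsnoc X x exc) (unsnoc X′ x′ exc′) =
    cong (_∷ʳ x) (prefix-unique rX rX′ (e ∷ Y) (e ∷ Y′) (unsnoc X x exc) (unsnoc X′ x exc′))

  exceptional-unique : ∀ {e R R′} → Exceptional G F R → e ∈ R → Exceptional G F R′ → e ∈ R′ → R′ ≡ R
  exceptional-unique {e} exc e∈R exc′ e∈R′ with X , Y , refl ← ∈-∃++ e∈R | X′ , Y′ , refl ← ∈-∃++ e∈R′ =
    sym (cong₂ (λ P S → P ++ e ∷ S) (prefix-unique (reverseView X) (reverseView X′) Y Y′ exc exc′)
                                     (suffix-unique X X′ Y Y′ exc exc′))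

theorem3p4 : (G : DAG) → (F : Framing G) → Full (DAG.graph G) → Ample G F →
    ∀ (e : E (DAG.graph G)) →
      Σ (List (E (DAG.graph G))) λ R → (Exceptional G F R × e ∈ R) ×
        (∀ R′ → Exceptional G F R′ → e ∈ R′ → R′ ≡ R)
theorem3p4 G F full ample e with R , exc , e∈R ← ample e (Routes.full⇒¬Idle (DAG.graph G) full e) =
  R , (exc , e∈R) , λ R′ exc′ e∈R′ → Uniqueness.exceptional-unique G F full ample exc e∈R exc′ e∈R′
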